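{- Consider the two-player guessing game on a finite simple directed graph $G=(V,E)$, in either the simultaneous or the alternating variant, and suppose the players follow a correct strategy. Let $(a,b)$ be a placement in which $A$ announces their position at step $n$ while $B$ has announced nothing before step $n$. Let $a'\neq a$ be a vertex adjacent to $b$ such that the placement $(a',b)$ is admissible, i.e. $(a',b)\in E$ if $(a,b)\in E$, and $(b,a')\in E$ if $(b,a)\in E$. Then in the placement $(a',b)$, player $B$ announces their correct position at some step $\le n-1$.
   Context: A simple directed graph has no loops and no two edges with the same ordered pair of endpoints. The game: a placement is an ordered pair $(a,b)$ of vertices with $(a,b)\in E$ or $(b,a)\in E$, meaning $A$ sits at $a$ and $B$ at $b$; the orientation of the edge between the players (whether it points from $A$ to $B$ or from $B$ to $A$) is part of the placement. Each player knows $G$, the vertex of the other player and this orientation, but not their own vertex. Time proceeds in steps $t=1,2,\dots$; at each step a player either stays silent or announces a vertex as their own position. In the simultaneous variant both players may speak at every step; in the alternating variant $A$ speaks only at odd and $B$ only at even steps. All announcements are heard by both. A strategy specifies for each player what to do at each step as a function of their information and the history of announcements. A strategy is correct if in every placement, whenever a player announces a vertex, it is their actual position. -}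

module Defs where

open import Data.Nat using (ℕ; zero; suc; _≤_; _<_)
open import Data.Fin using (Fin)
open import Data.Bool using (Bool; true; false; not; if_then_else_)
open import Data.Maybe using (Maybe; just; nothing)
open import Data.Product using (_×_; _,_)
open import Data.List using (List; []; _++_; [_])
open import Relation.Binary.PropositionalEquality using (_≡_)
open import Relation.Nullary using (¬_)
open import Level using (0ℓ)

-- Edges form a relation, so there are automatically no parallel edges with
-- the same ordered pair of endpoints; simplicity additionally forbids loops.
record Graph : Set₁ where
  field
    N      : ℕ
    Edge   : Fin N → Fin N → Set
    noLoop : ∀ v → ¬ Edge v v
open Graph public

data Orient : Set where
  A→B : Orient
  B→A : Orient

Oriented : (G : Graph) → Fin (N G) → Fin (N G) → Orient → Set
Oriented G a b A→B = Edge G a b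
Oriented G a b B→A = Edge G b a

data Variant : Set where
  simultaneous alternating : Variant

isOdd : ℕ → Bool
isOdd zero = false
isOdd (suc n) = not (isOdd n)

-- May A / B speak at step t (steps are t = 1, 2, ...)?
speaksA : Variant → ℕ → Bool
speaksA simultaneous t = true
speaksA alternating  t = isOdd t

speaksB : Variant → ℕ → Bool
speaksB simultaneous t = true
speaksB alternating  t = not (isOdd t)

-- An action at a step: silence (nothing) or announcing a vertex (just v).
-- A history is the list of (A's action , B's action) for steps 1, ..., k.
History : Graph → Set
History G = List (Maybe (Fin (N G)) × Maybe (Fin (N G)))

-- A strategy: A's move depends on B's vertex, the orientation and the
-- history so far (the step number is 1 + length of the history);
-- B's move depends on A's vertex, the orientation and the history.
record Strategy (G : Graph) : Set where
  field
    σA : Fin (N G) → Orient → History G → Maybe (Fin (N G))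
    σB : Fin (N G) → Orient → History G → Maybe (Fin (N G))
open Strategy public

module Play {G : Graph} (v : Variant) (S : Strategy G)
            (a b : Fin (N G)) (o : Orient) where
  hist : ℕ → History G
  -- actual action of A / B at step t (silent at steps where they may not speak,
  -- and at the nonexistent step 0)
  actA : ℕ → Maybe (Fin (N G))
  actB : ℕ → Maybe (Fin (N G))

  actA zero    = nothing
  actA (suc k) = if speaksA v (suc k) then σA S b o (hist k) else nothing
  actB zero    = nothing
  actB (suc k) = if speaksB v (suc k) then σB S a o (hist k) else nothing

  hist zero    = []
  hist (suc k) = hist k ++ [ (actA (suc k) , actB (suc k)) ]

actionA : {G : Graph} → Variant → Strategy G →
          (a b : Fin (N G)) → Orient → ℕ → Maybe (Fin (N G))
actionA v S a b o = Play.actA v S a b o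

actionB : {G : Graph} → Variant → Strategy G →
          (a b : Fin (N G)) → Orient → ℕ → Maybe (Fin (N G))
actionB v S a b o = Play.actB v S a b o

Correct : {G : Graph} → Variant → Strategy G → Set
Correct {G} v S =
  ∀ (a b : Fin (N G)) (o : Orient) → Oriented G a b o →
  ∀ (t : ℕ) (w : Fin (N G)) →
    (actionA v S a b o t ≡ just w → w ≡ a) ×
    (actionB v S a b o t ≡ just w → w ≡ b)

-- A's information in the placements (a , b) and (a' , b) is the same: B's
-- vertex, the orientation and the history. As long as B is silent in both
-- placements the histories coincide, so A would make the same announcement at
-- step n in both, which correctness forbids since a' ≢ a. Hence B must break
-- the silence in (a' , b) before step n, and by correctness correctly.
module Submission where

open import Defs
open import Data.Nat using (ℕ; zero; suc; _≤_; _<_; _∸_; s≤s; s≤s⁻¹; z≤n)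
open import Data.Nat.Properties using (≤-refl; m≤n⇒m≤1+n; m≤n⇒m<n∨m≡n)
open import Data.Fin using (Fin)
open import Data.Maybe using (Maybe; just; nothing)
open import Data.Product using (∃; ∃-syntax; _×_; _,_; proj₁; proj₂)
open import Data.Sum using (_⊎_; inj₁; inj₂)
open import Data.List using ([_]; _++_)
open import Data.Bool using (if_then_else_)
open import Data.Empty using (⊥-elim)
open import Relation.Binary.PropositionalEquality
  using (_≡_; _≢_; refl; sym; trans; cong; cong₂; subst)

silent-or-speaks : {X : Set} (f : ℕ → Maybe X) (m : ℕ) →
  (∀ t → 1 ≤ t → t ≤ m → f t ≡ nothing) ⊎
  (∃[ t ] ∃[ x ] (1 ≤ t × t ≤ m × f t ≡ just x))
silent-or-speaks f zero = inj₁ λ { _ () z≤n }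
silent-or-speaks f (suc m) with silent-or-speaks f m
... | inj₂ (t , x , 1≤t , t≤m , ft) = inj₂ (t , x , 1≤t , m≤n⇒m≤1+n t≤m , ft)
... | inj₁ silent with f (suc m) in fsm
...   | just x  = inj₂ (suc m , x , s≤s z≤n , ≤-refl , fsm)
...   | nothing = inj₁ silent′
  where
  silent′ : ∀ t → 1 ≤ t → t ≤ suc m → f t ≡ nothing
  silent′ t 1≤t t≤1+m with m≤n⇒m<n∨m≡n t≤1+m
  ... | inj₁ t<1+m = silent t 1≤t (s≤s⁻¹ t<1+m)
  ... | inj₂ refl  = fsm

module _ {G : Graph} (v : Variant) (S : Strategy G) (b : Fin (N G)) (o : Orient) where

  actionA-determined-by-history : ∀ {a a′} k →
    Play.hist v S a b o k ≡ Play.hist v S a′ b o k →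
    actionA v S a b o (suc k) ≡ actionA v S a′ b o (suc k)
  actionA-determined-by-history k =
    cong (λ h → if speaksA v (suc k) then σA S b o h else nothing)

  history-agree-while-B-silent : ∀ {a a′} m →
    (∀ t → 1 ≤ t → t ≤ m → actionB v S a b o t ≡ nothing) →
    (∀ t → 1 ≤ t → t ≤ m → actionB v S a′ b o t ≡ nothing) →
    Play.hist v S a b o m ≡ Play.hist v S a′ b o m
  history-agree-while-B-silent zero silent silent′ = refl
  history-agree-while-B-silent {a} {a′} (suc m) silent silent′ =
    cong₂ (λ h x → h ++ [ x ]) hist-m
      (cong₂ _,_ (actionA-determined-by-history m hist-m)
                 (trans (silent (suc m) (s≤s z≤n) ≤-refl)
                        (sym (silent′ (suc m) (s≤s z≤n) ≤-refl))))
    where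
    hist-m : Play.hist v S a b o m ≡ Play.hist v S a′ b o m
    hist-m = history-agree-while-B-silent m
      (λ t 1≤t t≤m → silent t 1≤t (m≤n⇒m≤1+n t≤m))
      (λ t 1≤t t≤m → silent′ t 1≤t (m≤n⇒m≤1+n t≤m))

lemma3p2 : (G : Graph) (v : Variant) (S : Strategy G) → Correct v S →
    (a b : Fin (N G)) (o : Orient) → Oriented G a b o →
    (n : ℕ) → 1 ≤ n → (∃[ w ] actionA v S a b o n ≡ just w) →
    (∀ t → 1 ≤ t → t < n → actionB v S a b o t ≡ nothing) →
    (a' : Fin (N G)) → a' ≢ a → Oriented G a' b o →
    ∃[ t ] (1 ≤ t × t ≤ n ∸ 1 × actionB v S a' b o t ≡ just b)
lemma3p2 G v S correct a b o e (suc m) _ (w , A-announces) silent a' a'≢a e'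
  with silent-or-speaks (actionB v S a' b o) m
... | inj₂ (t , x , 1≤t , t≤m , B-announces) =
  t , 1≤t , t≤m , subst (λ y → actionB v S a' b o t ≡ just y) x≡b B-announces
  where
  x≡b : x ≡ b
  x≡b = proj₂ (correct a' b o e' t x) B-announces
... | inj₁ silent′ = ⊥-elim (a'≢a (trans (sym w≡a') w≡a))
  where
  same-history : Play.hist v S a b o m ≡ Play.hist v S a' b o m
  same-history = history-agree-while-B-silent v S b o m
    (λ t 1≤t t≤m → silent t 1≤t (s≤s t≤m)) silent′
  A-announces′ : actionA v S a' b o (suc m) ≡ just w
  A-announces′ =
    trans (sym (actionA-determined-by-history v S b o m same-history)) A-announces
  w≡a : w ≡ a
  w≡a = proj₁ (correct a b o e (suc m) w) A-announces
  w≡a' : w ≡ a'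
  w≡a' = proj₁ (correct a' b o e' (suc m) w) A-announces′
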